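{- Let $p$ be a propositional variable and define $\alpha=\Box(p\to\Box(p\vee\neg p))$, $\beta=\Box(\bigcirc\Box(p\vee\neg p)\to p\vee\neg p\vee\bigcirc\Box\neg p)$, $\gamma=\Box(p\vee\neg p)\wedge\neg\Box\neg p$, and $\varphi=(\alpha\wedge\beta)\to\gamma$. Then $\Diamond p\leftrightarrow\varphi$ is valid over the class of here-and-there models. In particular, $\Diamond$ is definable over here-and-there models by a formula using only $\bot,\wedge,\vee,\to,\bigcirc,\Box$.
   Context: $\neg\theta$ abbreviates $\theta\to\bot$. A model is $(W,\preccurlyeq,S,V)$ with $\preccurlyeq$ a partial order on nonempty $W$, $S\colon W\to W$ forward confluent ($w\preccurlyeq v\Rightarrow S(w)\preccurlyeq S(v)$), and monotone $V\colon W\to\mathcal P(\mathbb P)$. Satisfaction: atoms by $V$; $\bot$ false; $\wedge,\vee$ classical; $w\models\bigcirc\varphi$ iff $S(w)\models\varphi$; $w\models\varphi\to\psi$ iff every $v\succcurlyeq w$ with $v\models\varphi$ has $v\models\psi$; $w\models\Diamond\varphi$ iff $S^k(w)\models\varphi$ for some $k\ge0$; $w\models\Box\varphi$ iff $S^k(w)\models\varphi$ for all $k\ge0$. A here-and-there model is a model with $W=T\times\{0,1\}$ for some set $T$ such that there is $f\colon T\to T$ with $(t,i)\preccurlyeq(s,j)$ iff $t=s$ and $i\le j$, and $S(t,i)=(f(t),i)$. -}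

module Defs where

open import Data.Nat using (ℕ; zero; suc)
open import Data.Bool using (Bool; false; true) renaming (_≤_ to _≤ᵇ_)
open import Data.Bool.Properties using () renaming (≤-isPartialOrder to ≤ᵇ-isPartialOrder)
open import Data.Product using (Σ; ∃; _×_; _,_; proj₁; proj₂)
open import Data.Sum using (_⊎_)
open import Data.Empty using (⊥)
open import Relation.Binary.PropositionalEquality
open import Relation.Binary.Structures using (IsPartialOrder; IsPreorder; IsEquivalence)
open import Relation.Binary.Definitions using (Reflexive; Transitive; Antisymmetric)

infixr 5 _⇒_
infixr 6 _∨_
infixr 7 _∧_
data Form : Set where
  var  : ℕ → Form
  ⊥'   : Form
  _∧_  : Form → Form → Form
  _∨_  : Form → Form → Form
  _⇒_  : Form → Form → Form
  ○    : Form → Form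
  ◇    : Form → Form
  □    : Form → Form

∼ : Form → Form
∼ θ = θ ⇒ ⊥'

_⇔_ : Form → Form → Form
φ ⇔ ψ = (φ ⇒ ψ) ∧ (ψ ⇒ φ)

record Model : Set₁ where
  field
    W        : Set
    inhabited : W
    _≼_      : W → W → Set
    isPO     : IsPartialOrder _≡_ _≼_
    S        : W → W
    confluent : ∀ {w v} → w ≼ v → S w ≼ S v
    V        : W → ℕ → Set
    monotone : ∀ {w v} → w ≼ v → ∀ q → V w q → V v q

iter : {A : Set} → (A → A) → ℕ → A → A
iter f zero a = a
iter f (suc k) a = f (iter f k a)

module _ (M : Model) where
  open Model M
  infix 4 _⊨_
  _⊨_ : W → Form → Set
  w ⊨ var q = V w q
  w ⊨ ⊥' = ⊥
  w ⊨ (φ ∧ ψ) = (w ⊨ φ) × (w ⊨ ψ)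
  w ⊨ (φ ∨ ψ) = (w ⊨ φ) ⊎ (w ⊨ ψ)
  w ⊨ (φ ⇒ ψ) = ∀ v → w ≼ v → v ⊨ φ → v ⊨ ψ
  w ⊨ ○ φ = S w ⊨ φ
  w ⊨ ◇ φ = ∃ λ k → iter S k w ⊨ φ
  w ⊨ □ φ = ∀ k → iter S k w ⊨ φ

_⊨[_]_ : (M : Model) → Model.W M → Form → Set
M ⊨[ w ] φ = _⊨_ M w φ

-- Here-and-there models: W = T × {0,1} (with {0,1} = Bool, false = 0, true = 1),
-- (t,i) ≼ (s,j) iff t = s and i ≤ j, and S(t,i) = (f t, i).
HTOrder : (T : Set) → T × Bool → T × Bool → Set
HTOrder T (t , i) (s , j) = (t ≡ s) × (i ≤ᵇ j)

private
  module BP = IsPartialOrder ≤ᵇ-isPartialOrder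

  ht-isPO : (T : Set) → IsPartialOrder _≡_ (HTOrder T)
  ht-isPO T = record
    { isPreorder = record
      { isEquivalence = isEquivalence
      ; reflexive = λ { refl → refl , BP.refl }
      ; trans = λ { (refl , p) (refl , q) → refl , BP.trans p q }
      }
    ; antisym = λ { {t , i} {.t , j} (refl , p) (_ , q) → cong (t ,_) (BP.antisym p q) }
    }

HTModel : (T : Set) → T → (f : T → T) → (V : T × Bool → ℕ → Set)
        → (∀ {w v} → HTOrder T w v → ∀ q → V w q → V v q) → Model
HTModel T t₀ f V mono = record
  { W = T × Bool
  ; inhabited = t₀ , false
  ; _≼_ = HTOrder T
  ; isPO = ht-isPO T
  ; S = λ { (t , i) → f t , i }
  ; confluent = λ { (refl , p) → refl , p }
  ; V = V
  ; monotone = mono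
  }

module _ (p : ℕ) where
  αf βf γf φf : Form
  αf = □ (var p ⇒ □ (var p ∨ ∼ (var p)))
  βf = □ (○ (□ (var p ∨ ∼ (var p))) ⇒ var p ∨ ∼ (var p) ∨ ○ (□ (∼ (var p))))
  γf = □ (var p ∨ ∼ (var p)) ∧ ∼ (□ (∼ (var p)))
  φf = (αf ∧ βf) ⇒ γf

-- The left-to-right direction holds in every model: if p occurs at the k-th
-- successor, α yields □(p ∨ ¬p) from there on, and β propagates it back one
-- step at a time, because its escape ○□¬p would contradict the later p;
-- moreover ◇p, being persistent, refutes □¬p at every later world.
-- Conversely, assume ¬◇p in a here-and-there model. The "there" worlds are
-- maximal, hence classical, and a "here" world sees only itself and its
-- "there" copy; so α holds because its antecedent p never holds at a "here"
-- world of the orbit, and β holds because under ¬◇p the premise ○□(p ∨ ¬p)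
-- already gives ○□¬p. Then γ yields □(p ∨ ¬p), which with ¬◇p gives □¬p,
-- contradicting ¬□¬p; excluded middle turns ¬¬◇p into ◇p.
module Submission where

open import Defs
open import Data.Nat using (ℕ; zero; suc; _+_)
open import Data.Bool using (Bool; true; false; f≤t; b≤b)
open import Data.Product using (_×_; _,_; proj₁)
open import Data.Sum using (inj₁; inj₂; map₂)
open import Function using (_∘_)
open import Data.Empty using (⊥-elim)
open import Relation.Nullary using (¬_; yes; no)
open import Relation.Nullary.Decidable using (decidable-stable)
open import Relation.Binary.PropositionalEquality
open import Relation.Binary.Structures using (IsPartialOrder)
open import Axiom.ExcludedMiddle using (ExcludedMiddle)
open import Level using (0ℓ)

module _ {A : Set} (f : A → A) where

  iter-comm : ∀ k x → iter f k (f x) ≡ f (iter f k x)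
  iter-comm zero    x = refl
  iter-comm (suc k) x = cong f (iter-comm k x)

  iter-+ : ∀ m n x → iter f m (iter f n x) ≡ iter f (m + n) x
  iter-+ zero    n x = refl
  iter-+ (suc m) n x = cong f (iter-+ m n x)

module ModelFacts (M : Model) where
  open Model M

  infix 4 _⊩_
  _⊩_ : W → Form → Set
  _⊩_ = _⊨_ M

  ≼-refl : ∀ {w} → w ≼ w
  ≼-refl = IsPartialOrder.refl isPO

  ≼-trans : ∀ {u v w} → u ≼ v → v ≼ w → u ≼ w
  ≼-trans = IsPartialOrder.trans isPO

  iter-confluent : ∀ k {w v} → w ≼ v → iter S k w ≼ iter S k v
  iter-confluent zero    w≼v = w≼v
  iter-confluent (suc k) w≼v = confluent (iter-confluent k w≼v)

  ⊩-mono : ∀ φ {w v} → w ≼ v → w ⊩ φ → v ⊩ φ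
  ⊩-mono (var q)  w≼v h               = monotone w≼v q h
  ⊩-mono ⊥'       w≼v ()
  ⊩-mono (φ ∧ ψ)  w≼v (hφ , hψ)       = ⊩-mono φ w≼v hφ , ⊩-mono ψ w≼v hψ
  ⊩-mono (φ ∨ ψ)  w≼v (inj₁ hφ)       = inj₁ (⊩-mono φ w≼v hφ)
  ⊩-mono (φ ∨ ψ)  w≼v (inj₂ hψ)       = inj₂ (⊩-mono ψ w≼v hψ)
  ⊩-mono (φ ⇒ ψ)  w≼v h u v≼u         = h u (≼-trans w≼v v≼u)
  ⊩-mono (○ φ)    w≼v h               = ⊩-mono φ (confluent w≼v) h
  ⊩-mono (◇ φ)    w≼v (k , h)         = k , ⊩-mono φ (iter-confluent k w≼v) h
  ⊩-mono (□ φ)    w≼v h k             = ⊩-mono φ (iter-confluent k w≼v) (h k)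

  □-tail : ∀ {w} φ → w ⊩ □ φ → S w ⊩ □ φ
  □-tail {w} φ h k = subst (_⊩ φ) (sym (iter-comm S k w)) (h (suc k))

  □-cons : ∀ {w} φ → w ⊩ φ → S w ⊩ □ φ → w ⊩ □ φ
  □-cons     φ h₀ h zero    = h₀
  □-cons {w} φ h₀ h (suc k) = subst (_⊩ φ) (iter-comm S k w) (h k)

  ◇-iter : ∀ {w} k φ → iter S k w ⊩ ◇ φ → w ⊩ ◇ φ
  ◇-iter {w} k φ (m , h) = m + k , subst (_⊩ φ) (iter-+ S m k w) h

  ◇⇒¬□¬ : ∀ {w} φ → w ⊩ ◇ φ → w ⊩ ∼ (□ (∼ φ))
  ◇⇒¬□¬ φ h u w≼u □¬φ with ⊩-mono (◇ φ) w≼u h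
  ... | k , hφ = □¬φ k _ ≼-refl hφ

  □-excluded-middle⇒□¬ : ∀ {w} φ → w ⊩ □ (φ ∨ ∼ φ) → ¬ (w ⊩ ◇ φ) → w ⊩ □ (∼ φ)
  □-excluded-middle⇒□¬ φ h ¬◇φ k with h k
  ... | inj₁ hφ  = ⊥-elim (¬◇φ (k , hφ))
  ... | inj₂ h¬φ = h¬φ

  module _ (p : ℕ) where

    excluded-middle : Form
    excluded-middle = var p ∨ ∼ (var p)

    α-body β-conclusion β-body : Form
    α-body = var p ⇒ □ excluded-middle
    β-conclusion = var p ∨ ∼ (var p) ∨ ○ (□ (∼ (var p)))
    β-body = ○ (□ excluded-middle) ⇒ β-conclusion

    eventually-α∧β⇒□excluded-middle : ∀ k {w} → iter S k w ⊩ var p →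
      w ⊩ αf p → w ⊩ βf p → w ⊩ □ excluded-middle
    eventually-α∧β⇒□excluded-middle zero    hp α β = α 0 _ ≼-refl hp
    eventually-α∧β⇒□excluded-middle (suc k) {w} hp α β =
      □-cons excluded-middle em-w □em-S
      where
      hp-S : iter S k (S w) ⊩ var p
      hp-S = subst (_⊩ var p) (sym (iter-comm S k w)) hp

      □em-S : S w ⊩ □ excluded-middle
      □em-S = eventually-α∧β⇒□excluded-middle k
                hp-S (□-tail α-body α) (□-tail β-body β)

      em-w : w ⊩ excluded-middle
      em-w with β 0 _ ≼-refl □em-S
      ... | inj₁ hp₀          = inj₁ hp₀
      ... | inj₂ (inj₁ h¬p₀)  = inj₂ h¬p₀
      ... | inj₂ (inj₂ ○□¬p) = ⊥-elim (○□¬p k _ ≼-refl hp-S)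

    ◇⇒φ : ∀ {w} → w ⊩ ◇ (var p) → w ⊩ φf p
    ◇⇒φ ◇p v w≼v (α , β) with ⊩-mono (◇ (var p)) w≼v ◇p
    ... | k , hp = eventually-α∧β⇒□excluded-middle k hp α β , ◇⇒¬□¬ (var p) (k , hp)

    ¬◇∧α∧β⇒¬φ : ∀ {w} → ¬ (w ⊩ ◇ (var p)) → w ⊩ αf p → w ⊩ βf p → ¬ (w ⊩ φf p)
    ¬◇∧α∧β⇒¬φ ¬◇p α β φ with φ _ ≼-refl (α , β)
    ... | □em , ¬□¬p = ¬□¬p _ ≼-refl (□-excluded-middle⇒□¬ (var p) □em ¬◇p)

module HereAndThere (em : ExcludedMiddle 0ℓ)
    (T : Set) (t₀ : T) (f : T → T) (V : T × Bool → ℕ → Set)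
    (mono : ∀ {w v} → HTOrder T w v → ∀ q → V w q → V v q) where

  open Model (HTModel T t₀ f V mono) using (W; S; _≼_)
  open ModelFacts (HTModel T t₀ f V mono)

  iter-S : ∀ k t i → iter S k (t , i) ≡ (iter f k t , i)
  iter-S zero    t i = refl
  iter-S (suc k) t i = cong S (iter-S k t i)

  ≼-cases : ∀ {P : W → Set} {x u} → P x → P (proj₁ x , true) → x ≼ u → P u
  ≼-cases {x = _ , false} {u = _ , false} px pt (refl , b≤b) = px
  ≼-cases {x = _ , false} {u = _ , true}  px pt (refl , f≤t) = pt
  ≼-cases {x = _ , true}  {u = _ , true}  px pt (refl , b≤b) = px

  ⇒-intro : ∀ {x} φ ψ → (x ⊩ φ → x ⊩ ψ) → ((proj₁ x , true) ⊩ φ → (proj₁ x , true) ⊩ ψ) →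
            x ⊩ φ ⇒ ψ
  ⇒-intro φ ψ hx ht _ = ≼-cases {P = λ u → u ⊩ φ → u ⊩ ψ} hx ht

  there⊩excluded-middle : ∀ s φ → (s , true) ⊩ φ ∨ ∼ φ
  there⊩excluded-middle s φ with em {(s , true) ⊩ φ}
  ... | yes hφ = inj₁ hφ
  ... | no ¬hφ = inj₂ (λ u → ≼-cases {P = λ u → ¬ (u ⊩ φ)} ¬hφ ¬hφ)

  there⊩□excluded-middle : ∀ s φ → (s , true) ⊩ □ (φ ∨ ∼ φ)
  there⊩□excluded-middle s φ k =
    subst (_⊩ φ ∨ ∼ φ) (sym (iter-S k s true)) (there⊩excluded-middle (iter f k s) φ)

  module _ (p : ℕ) where

    ¬◇⇒α : ∀ {w} → ¬ (w ⊩ ◇ (var p)) → w ⊩ αf p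
    ¬◇⇒α ¬◇p k = ⇒-intro (var p) (□ (excluded-middle p))
      (λ hp → ⊥-elim (¬◇p (k , hp)))
      (λ _ → there⊩□excluded-middle _ (var p))

    ¬◇⇒β : ∀ {w} → ¬ (w ⊩ ◇ (var p)) → w ⊩ βf p
    ¬◇⇒β ¬◇p k = ⇒-intro (○ (□ (excluded-middle p))) (β-conclusion p)
      (λ ○□em → inj₂ (inj₂ (□-excluded-middle⇒□¬ (var p) ○□em (¬◇p ∘ ◇-iter (suc k) (var p)))))
      (λ _ → map₂ inj₁ (there⊩excluded-middle _ (var p)))

    φ⇒◇ : ∀ {w} → w ⊩ φf p → w ⊩ ◇ (var p)
    φ⇒◇ φ = decidable-stable em (λ ¬◇p → ¬◇∧α∧β⇒¬φ p ¬◇p (¬◇⇒α ¬◇p) (¬◇⇒β ¬◇p) φ)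

proposition8p3 : ExcludedMiddle 0ℓ →
    (p : ℕ) (T : Set) (t₀ : T) (f : T → T) (V : T × Bool → ℕ → Set)
    (mono : ∀ {w v} → HTOrder T w v → ∀ q → V w q → V v q)
    (w : T × Bool) →
    HTModel T t₀ f V mono ⊨[ w ] (◇ (var p) ⇔ φf p)
proposition8p3 em p T t₀ f V mono w = (λ _ _ → ◇⇒φ p) , (λ _ _ → φ⇒◇ p)
  where
  open ModelFacts (HTModel T t₀ f V mono)
  open HereAndThere em T t₀ f V mono
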